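{- For every even integer $n\ge4$, there does not exist a $3$-IMOFS$(n;n-2)$.
   Context: For positive even integers $s<n$, an incomplete frequency square of type $(n;s)$ is an $n\times n$ array indexed by $\{1,\dots,n\}^2$ whose cells in $\{1,\dots,s\}\times\{1,\dots,s\}$ are empty, whose other cells contain $0$ or $1$, and in which every row and every column contains equally many $0$'s and $1$'s. Two such arrays are orthogonal if, when superimposed (on the non-empty cells), each of the ordered pairs $(0,0),(0,1),(1,0),(1,1)$ occurs the same number of times. A $k$-IMOFS$(n;s)$ is a set of $k$ pairwise orthogonal incomplete frequency squares of type $(n;s)$. -}

module Defs where

open import Data.Nat using (ℕ; _<ᵇ_)
open import Data.Bool using (Bool; true; false; _∧_; not; if_then_else_)
open import Data.Fin using (Fin; toℕ)
open import Data.List using (List; length; filter; allFin; concatMap; map)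
open import Data.Product using (_×_; _,_)
open import Relation.Binary.PropositionalEquality using (_≡_)
open import Relation.Nullary using (¬_)
open import Relation.Nullary.Decidable using (does)
open import Data.Bool.Properties using () renaming (_≟_ to _≟ᵇ_)
open import Relation.Unary using (Decidable)
open import Data.Bool using (T)
open import Data.Unit using (⊤; tt)

-- An n×n array with entries in Bool (false = 0, true = 1), indexed by Fin n × Fin n
-- (Fin index i corresponds to the paper's row i+1). Entries in the empty
-- block {0..s-1}×{0..s-1} are simply ignored.
Array : ℕ → Set
Array n = Fin n → Fin n → Bool

filled : {n : ℕ} → ℕ → Fin n → Fin n → Bool
filled s i j = not ((toℕ i <ᵇ s) ∧ (toℕ j <ᵇ s))

count : {A : Set} → (A → Bool) → List A → ℕ
count p xs = length (filter (λ x → T? (p x)) xs)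
  where
  open import Relation.Nullary using (Dec; yes; no)
  T? : (b : Bool) → Dec (T b)
  T? true = yes tt
  T? false = no (λ ())

_==_ : Bool → Bool → Bool
true == true = true
false == false = true
_ == _ = false

IsIFS : (n s : ℕ) → Array n → Set
IsIFS n s A =
  ((i : Fin n) →
     count (λ j → filled s i j ∧ (A i j == false)) (allFin n)
   ≡ count (λ j → filled s i j ∧ (A i j == true)) (allFin n))
  × ((j : Fin n) →
     count (λ i → filled s i j ∧ (A i j == false)) (allFin n)
   ≡ count (λ i → filled s i j ∧ (A i j == true)) (allFin n))

cells : (n : ℕ) → List (Fin n × Fin n)
cells n = concatMap (λ i → map (λ j → (i , j)) (allFin n)) (allFin n)

pairCount : (n s : ℕ) → Array n → Array n → Bool → Bool → ℕ
pairCount n s A B a b =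
  count (λ { (i , j) → filled s i j ∧ (A i j == a) ∧ (B i j == b) }) (cells n)

Orthogonal : (n s : ℕ) → Array n → Array n → Set
Orthogonal n s A B =
  (pairCount n s A B false false ≡ pairCount n s A B false true)
  × (pairCount n s A B false true ≡ pairCount n s A B true false)
  × (pairCount n s A B true false ≡ pairCount n s A B true true)

IMOFS : (k n s : ℕ) → (Fin k → Array n) → Set
IMOFS k n s F =
  ((a : Fin k) → IsIFS n s (F a))
  × ((a b : Fin k) → ¬ (a ≡ b) → Orthogonal n s (F a) (F b))

-- Write n = t + 2, so the filled cells are those in the last two rows and columns. In each
-- square, a short line has just two filled cells, so along the strips column b (row b) is the
-- complement of column a (row a); with the two full rows this leaves exactly two 1s in the
-- 2 × 2 corner. In an orthogonal pair the cell value (1,1) occurs 4(t + 1)/4 = t + 1 times,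
-- which is odd. Counting these cells modulo 2, the strip contributions cancel against the
-- balance of row a and column a, leaving a parity condition on the two corners alone, and
-- no three corners of weight two satisfy it pairwise.
module Submission where

open import Defs
open import Data.Nat using (ℕ; _≤_; _∸_; _*_)
open import Data.Fin using (Fin)
open import Data.Product using (Σ)
open import Relation.Nullary using (¬_)
open import Relation.Binary.PropositionalEquality using (_≡_)

open import Data.Bool using (Bool; true; false; _∧_; not)
open import Data.Bool.Properties using (∧-identityʳ; ∧-zeroʳ; T-≡)
open import Data.Fin using (zero; suc; toℕ; inject₁; fromℕ)
open import Data.Fin.Patterns using (0F; 1F; 2F)
open import Data.Fin.Properties using (toℕ-inject₁; toℕ-fromℕ; toℕ<n)
open import Data.List using (List; allFin; []; _∷_; _++_; map; tabulate; concatMap)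
open import Data.Nat using (zero; suc; _+_; _≟_; _<_; _<ᵇ_; z≤n; s≤s; parity)
open import Data.Nat.Properties
  using (+-*-semiring; +-comm; +-assoc; +-identityʳ; *-identityʳ; +-cancelˡ-≡; *-cancelˡ-≡; ≤-refl; n≤1+n; <⇒<ᵇ)
open import Data.Nat.Solver using (module +-*-Solver)
open import Algebra.Properties.Semiring.Sum +-*-semiring
  using (sum-syntax; ∑-distrib-+; sum-cong-≗; sum-init-last; sum-replicate-zero; *-distribˡ-sum)
open import Data.Parity.Base as ℙ using (0ℙ; 1ℙ)
open import Data.Parity.Properties as ℙ using (+-homo-+; *-homo-*) renaming (_≟_ to _≟ℙ_)
open import Data.Product using (_×_; _,_; proj₁; proj₂)
open import Function using (_∘_; Equivalence)
open import Relation.Binary.PropositionalEquality using (refl; sym; trans; cong; cong₂; subst; module ≡-Reasoning)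
open import Relation.Nullary using (Dec)
open import Relation.Nullary.Decidable using (map′; _×-dec_; ¬?; toWitness)

open +-*-Solver using (solve; _:+_; _:*_; _:=_; con)

⟦_⟧ : Bool → ℕ
⟦ true ⟧ = 1
⟦ false ⟧ = 0

∑-const : ∀ n c → ∑[ i < n ] c ≡ n * c
∑-const zero c = refl
∑-const (suc n) c = cong (c +_) (∑-const n c)

count-∷ : {A : Set} (p : A → Bool) (x : A) (xs : List A) →
  count p (x ∷ xs) ≡ ⟦ p x ⟧ + count p xs
count-∷ p x xs with p x
... | true = refl
... | false = refl

count-++ : {A : Set} (p : A → Bool) (xs ys : List A) →
  count p (xs ++ ys) ≡ count p xs + count p ys
count-++ p [] ys = refl
count-++ p (x ∷ xs) ys = begin
  count p (x ∷ xs ++ ys)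
    ≡⟨ count-∷ p x (xs ++ ys) ⟩
  ⟦ p x ⟧ + count p (xs ++ ys)
    ≡⟨ cong (⟦ p x ⟧ +_) (count-++ p xs ys) ⟩
  ⟦ p x ⟧ + (count p xs + count p ys) ≡⟨ sym (+-assoc ⟦ p x ⟧ _ _) ⟩
  ⟦ p x ⟧ + count p xs + count p ys
    ≡⟨ cong (_+ count p ys) (sym (count-∷ p x xs)) ⟩
  count p (x ∷ xs) + count p ys ∎
  where open ≡-Reasoning

count-map : {A B : Set} (p : B → Bool) (f : A → B) (xs : List A) →
  count p (map f xs) ≡ count (p ∘ f) xs
count-map p f [] = refl
count-map p f (x ∷ xs) =
  trans (count-∷ p (f x) (map f xs))
    (trans (cong (⟦ p (f x) ⟧ +_) (count-map p f xs)) (sym (count-∷ (p ∘ f) x xs)))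

count-tabulate : {A : Set} (p : A → Bool) {n : ℕ} (g : Fin n → A) →
  count p (tabulate g) ≡ ∑[ i < n ] ⟦ p (g i) ⟧
count-tabulate p {zero} g = refl
count-tabulate p {suc n} g =
  trans (count-∷ p (g zero) _) (cong (⟦ p (g zero) ⟧ +_) (count-tabulate p (g ∘ suc)))

count-allFin : {n : ℕ} (p : Fin n → Bool) → count p (allFin n) ≡ ∑[ i < n ] ⟦ p i ⟧
count-allFin p = count-tabulate p (λ i → i)

count-concatMap-tabulate : {A B : Set} (p : B → Bool) (f : A → List B) {n : ℕ} (g : Fin n → A) →
  count p (concatMap f (tabulate g)) ≡ ∑[ i < n ] count p (f (g i))
count-concatMap-tabulate p f {zero} g = refl
count-concatMap-tabulate p f {suc n} g =
  trans (count-++ p (f (g zero)) _)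
    (cong (count p (f (g zero)) +_) (count-concatMap-tabulate p f (g ∘ suc)))

count-cells : {n : ℕ} (p : Fin n × Fin n → Bool) →
  count p (cells n) ≡ ∑[ i < n ] ∑[ j < n ] ⟦ p (i , j) ⟧
count-cells {n} p =
  trans (count-concatMap-tabulate p (λ i → map (i ,_) (allFin n)) (λ i → i))
    (sum-cong-≗ λ i → trans (count-map p (i ,_) (allFin n)) (count-allFin (λ j → p (i , j))))

==-true : ∀ x → (x == true) ≡ x
==-true true = refl
==-true false = refl

⟦∧==false⟧+⟦∧⟧ : ∀ p x → ⟦ p ∧ (x == false) ⟧ + ⟦ p ∧ x ⟧ ≡ ⟦ p ⟧
⟦∧==false⟧+⟦∧⟧ false x = refl
⟦∧==false⟧+⟦∧⟧ true false = refl
⟦∧==false⟧+⟦∧⟧ true true = refl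

⟦⟧+⟦not⟧ : ∀ x → ⟦ x ⟧ + ⟦ not x ⟧ ≡ 1
⟦⟧+⟦not⟧ true = refl
⟦⟧+⟦not⟧ false = refl

⟦⟧+⟦⟧≡1 : ∀ x y → ⟦ x ⟧ + ⟦ y ⟧ ≡ 1 → y ≡ not x
⟦⟧+⟦⟧≡1 false true _ = refl
⟦⟧+⟦⟧≡1 true false _ = refl

⟦∧⟧+⟦not∧not⟧ : ∀ x y → ⟦ x ∧ y ⟧ + ⟦ not x ∧ not y ⟧ ≡ ⟦ x == y ⟧
⟦∧⟧+⟦not∧not⟧ true true = refl
⟦∧⟧+⟦not∧not⟧ true false = refl
⟦∧⟧+⟦not∧not⟧ false true = refl
⟦∧⟧+⟦not∧not⟧ false false = refl

⟦==⟧+⟦⟧+⟦⟧ : ∀ x y → ⟦ x == y ⟧ + (⟦ x ⟧ + ⟦ y ⟧) ≡ 1 + 2 * ⟦ x ∧ y ⟧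
⟦==⟧+⟦⟧+⟦⟧ true true = refl
⟦==⟧+⟦⟧+⟦⟧ true false = refl
⟦==⟧+⟦⟧+⟦⟧ false true = refl
⟦==⟧+⟦⟧+⟦⟧ false false = refl

⟦∧==∧==⟧-partition : ∀ p x y →
  ⟦ p ∧ (x == false) ∧ (y == false) ⟧ + ⟦ p ∧ (x == false) ∧ (y == true) ⟧
    + ⟦ p ∧ (x == true) ∧ (y == false) ⟧ + ⟦ p ∧ (x == true) ∧ (y == true) ⟧ ≡ ⟦ p ⟧
⟦∧==∧==⟧-partition false x y = refl
⟦∧==∧==⟧-partition true false false = refl
⟦∧==∧==⟧-partition true false true = refl
⟦∧==∧==⟧-partition true true false = refl
⟦∧==∧==⟧-partition true true true = refl

∑∑-distrib-+ : ∀ {m n} (f g : Fin m → Fin n → ℕ) →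
  ∑[ i < m ] ∑[ j < n ] f i j + ∑[ i < m ] ∑[ j < n ] g i j ≡ ∑[ i < m ] ∑[ j < n ] (f i j + g i j)
∑∑-distrib-+ {m} {n} f g =
  trans (sym (∑-distrib-+ (λ i → ∑[ j < n ] f i j) (λ i → ∑[ j < n ] g i j)))
    (sum-cong-≗ λ i → sym (∑-distrib-+ (f i) (g i)))

∑-agreements : ∀ {t} (u v : Fin t → Bool) →
  ∑[ k < t ] ⟦ u k == v k ⟧ + (∑[ k < t ] ⟦ u k ⟧ + ∑[ k < t ] ⟦ v k ⟧) ≡ t + 2 * ∑[ k < t ] ⟦ u k ∧ v k ⟧
∑-agreements {t} u v = begin
  ∑[ k < t ] ⟦ u k == v k ⟧ + (∑[ k < t ] ⟦ u k ⟧ + ∑[ k < t ] ⟦ v k ⟧)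
    ≡⟨ cong (∑[ k < t ] ⟦ u k == v k ⟧ +_) (∑-distrib-+ (λ k → ⟦ u k ⟧) (λ k → ⟦ v k ⟧)) ⟨
  ∑[ k < t ] ⟦ u k == v k ⟧ + ∑[ k < t ] (⟦ u k ⟧ + ⟦ v k ⟧)
    ≡⟨ ∑-distrib-+ (λ k → ⟦ u k == v k ⟧) (λ k → ⟦ u k ⟧ + ⟦ v k ⟧) ⟨
  ∑[ k < t ] (⟦ u k == v k ⟧ + (⟦ u k ⟧ + ⟦ v k ⟧))
    ≡⟨ sum-cong-≗ (λ k → ⟦==⟧+⟦⟧+⟦⟧ (u k) (v k)) ⟩
  ∑[ k < t ] (1 + 2 * ⟦ u k ∧ v k ⟧)
    ≡⟨ ∑-distrib-+ (λ _ → 1) (λ k → 2 * ⟦ u k ∧ v k ⟧) ⟩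
  ∑[ k < t ] 1 + ∑[ k < t ] (2 * ⟦ u k ∧ v k ⟧)
    ≡⟨ cong₂ _+_ (trans (∑-const t 1) (*-identityʳ t)) (sym (*-distribˡ-sum 2 (λ k → ⟦ u k ∧ v k ⟧))) ⟩
  t + 2 * ∑[ k < t ] ⟦ u k ∧ v k ⟧ ∎
  where open ≡-Reasoning

parity-+-double : ∀ x k → parity (x + 2 * k) ≡ parity x
parity-+-double x k =
  trans (+-homo-+ x (2 * k)) (trans (cong (parity x ℙ.+_) (*-homo-* 2 k)) (ℙ.+-identityʳ (parity x)))

halves-equal : ∀ {x y m} → 2 * x ≡ m → 2 * y ≡ m → x ≡ y
halves-equal {x} {y} 2x≡m 2y≡m = *-cancelˡ-≡ x y 2 (trans 2x≡m (sym 2y≡m))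

balanced⇒2*ones : ∀ {n} (p x : Fin n → Bool) →
  ∑[ i < n ] ⟦ p i ∧ (x i == false) ⟧ ≡ ∑[ i < n ] ⟦ p i ∧ (x i == true) ⟧ →
  2 * ∑[ i < n ] ⟦ p i ∧ x i ⟧ ≡ ∑[ i < n ] ⟦ p i ⟧
balanced⇒2*ones {n} p x balanced = begin
  2 * ones
    ≡⟨ cong (ones +_) (+-identityʳ ones) ⟩
  ones + ones
    ≡⟨ cong (_+ ones) (trans (sym ones-is-true) (sym balanced)) ⟩
  ∑[ i < n ] ⟦ p i ∧ (x i == false) ⟧ + ones
    ≡⟨ sym (∑-distrib-+ (λ i → ⟦ p i ∧ (x i == false) ⟧) (λ i → ⟦ p i ∧ x i ⟧)) ⟩
  ∑[ i < n ] (⟦ p i ∧ (x i == false) ⟧ + ⟦ p i ∧ x i ⟧)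
    ≡⟨ sum-cong-≗ (λ i → ⟦∧==false⟧+⟦∧⟧ (p i) (x i)) ⟩
  ∑[ i < n ] ⟦ p i ⟧ ∎
  where
  open ≡-Reasoning
  ones : ℕ
  ones = ∑[ i < n ] ⟦ p i ∧ x i ⟧
  ones-is-true : ∑[ i < n ] ⟦ p i ∧ (x i == true) ⟧ ≡ ones
  ones-is-true = sum-cong-≗ λ i → cong (λ y → ⟦ p i ∧ y ⟧) (==-true (x i))

module Balanced {n : ℕ} (s : ℕ) (X : Array n) (X-ifs : IsIFS n s X) where

  row-ones : ∀ i → 2 * ∑[ j < n ] ⟦ filled s i j ∧ X i j ⟧ ≡ ∑[ j < n ] ⟦ filled s i j ⟧
  row-ones i = balanced⇒2*ones (filled s i) (X i)
    (trans (sym (count-allFin (λ j → filled s i j ∧ (X i j == false))))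
      (trans (proj₁ X-ifs i) (count-allFin (λ j → filled s i j ∧ (X i j == true)))))

  col-ones : ∀ j → 2 * ∑[ i < n ] ⟦ filled s i j ∧ X i j ⟧ ≡ ∑[ i < n ] ⟦ filled s i j ⟧
  col-ones j = balanced⇒2*ones (λ i → filled s i j) (λ i → X i j)
    (trans (sym (count-allFin (λ i → filled s i j ∧ (X i j == false))))
      (trans (proj₂ X-ifs j) (count-allFin (λ i → filled s i j ∧ (X i j == true)))))

  full-row-ones : ∀ i → (∀ j → filled s i j ≡ true) → 2 * ∑[ j < n ] ⟦ X i j ⟧ ≡ n
  full-row-ones i full = begin
    2 * ∑[ j < n ] ⟦ X i j ⟧
      ≡⟨ cong (2 *_) (sum-cong-≗ λ j → cong (λ f → ⟦ f ∧ X i j ⟧) (sym (full j))) ⟩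
    2 * ∑[ j < n ] ⟦ filled s i j ∧ X i j ⟧ ≡⟨ row-ones i ⟩
    ∑[ j < n ] ⟦ filled s i j ⟧
      ≡⟨ sum-cong-≗ (cong ⟦_⟧ ∘ full) ⟩
    ∑[ j < n ] 1
      ≡⟨ trans (∑-const n 1) (*-identityʳ n) ⟩
    n ∎
    where open ≡-Reasoning

  full-col-ones : ∀ j → (∀ i → filled s i j ≡ true) → 2 * ∑[ i < n ] ⟦ X i j ⟧ ≡ n
  full-col-ones j full = begin
    2 * ∑[ i < n ] ⟦ X i j ⟧
      ≡⟨ cong (2 *_) (sum-cong-≗ λ i → cong (λ f → ⟦ f ∧ X i j ⟧) (sym (full i))) ⟩
    2 * ∑[ i < n ] ⟦ filled s i j ∧ X i j ⟧ ≡⟨ col-ones j ⟩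
    ∑[ i < n ] ⟦ filled s i j ⟧
      ≡⟨ sum-cong-≗ (cong ⟦_⟧ ∘ full) ⟩
    ∑[ i < n ] 1
      ≡⟨ trans (∑-const n 1) (*-identityʳ n) ⟩
    n ∎
    where open ≡-Reasoning

record Corner : Set where
  constructor corner
  field
    c₁₁ c₁₂ c₂₁ c₂₂ : Bool

open Corner

weight : Corner → ℕ
weight c = (⟦ c₁₁ c ⟧ + ⟦ c₁₂ c ⟧) + (⟦ c₂₁ c ⟧ + ⟦ c₂₂ c ⟧)

offDiagonal : Corner → ℕ
offDiagonal c = ⟦ c₁₂ c ⟧ + ⟦ c₂₁ c ⟧

sharedOnes : Corner → Corner → ℕ
sharedOnes c d = (⟦ c₁₁ c ∧ c₁₁ d ⟧ + ⟦ c₁₂ c ∧ c₁₂ d ⟧) + (⟦ c₂₁ c ∧ c₂₁ d ⟧ + ⟦ c₂₂ c ∧ c₂₂ d ⟧)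

Compatible : Corner → Corner → Set
Compatible c d = parity (sharedOnes c d + offDiagonal c + offDiagonal d) ≡ 1ℙ

CompatibleTriangle : Corner → Corner → Corner → Set
CompatibleTriangle x y z =
  weight x ≡ 2 × weight y ≡ 2 × weight z ≡ 2 × Compatible x y × Compatible x z × Compatible y z

∀-Bool? : {P : Bool → Set} → (∀ b → Dec (P b)) → Dec (∀ b → P b)
∀-Bool? P? = map′ (λ { (pt , pf) true → pt ; (pt , pf) false → pf }) (λ h → h true , h false)
  (P? true ×-dec P? false)

∀-Corner? : {P : Corner → Set} → (∀ c → Dec (P c)) → Dec (∀ c → P c)
∀-Corner? P? = map′ (λ h c → h (c₁₁ c) (c₁₂ c) (c₂₁ c) (c₂₂ c)) (λ h a b c d → h (corner a b c d))
  (∀-Bool? λ a → ∀-Bool? λ b → ∀-Bool? λ c → ∀-Bool? λ d → P? (corner a b c d))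

compatibleTriangle? : ∀ x y z → Dec (CompatibleTriangle x y z)
compatibleTriangle? x y z =
  weight x ≟ 2 ×-dec weight y ≟ 2 ×-dec weight z ≟ 2 ×-dec
  compatible? x y ×-dec compatible? x z ×-dec compatible? y z
  where
  compatible? : ∀ c d → Dec (Compatible c d)
  compatible? c d = parity (sharedOnes c d + offDiagonal c + offDiagonal d) ≟ℙ 1ℙ

-- On the six corners of weight two, compatibility is a 4-cycle plus two isolated vertices.
no-compatible-triangle : ∀ x y z → ¬ CompatibleTriangle x y z
no-compatible-triangle =
  toWitness {a? = ∀-Corner? λ x → ∀-Corner? λ y → ∀-Corner? λ z → ¬? (compatibleTriangle? x y z)} _

≥⇒<ᵇ≡false : ∀ {m n} → n ≤ m → (m <ᵇ n) ≡ false
≥⇒<ᵇ≡false z≤n = refl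
≥⇒<ᵇ≡false (s≤s n≤m) = ≥⇒<ᵇ≡false n≤m

<⇒<ᵇ≡true : ∀ {m n} → m < n → (m <ᵇ n) ≡ true
<⇒<ᵇ≡true m<n = Equivalence.to T-≡ (<⇒<ᵇ m<n)

-- The empty block occupies the indices strip k = k < t; the lines a = t and b = t + 1 are full.
module Border (t : ℕ) where

  n : ℕ
  n = suc (suc t)

  strip : Fin t → Fin n
  strip k = inject₁ (inject₁ k)

  a b : Fin n
  a = inject₁ (fromℕ t)
  b = fromℕ (suc t)

  ∑-split : (f : Fin n → ℕ) → ∑[ i < n ] f i ≡ ∑[ k < t ] f (strip k) + f a + f b
  ∑-split f = trans (sum-init-last f) (cong (_+ f b) (sum-init-last (f ∘ inject₁)))

  inBlock : Fin n → Bool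
  inBlock i = toℕ i <ᵇ t

  strip-inBlock : ∀ k → inBlock (strip k) ≡ true
  strip-inBlock k = <⇒<ᵇ≡true (subst (_< t) (sym (trans (toℕ-inject₁ (inject₁ k)) (toℕ-inject₁ k))) (toℕ<n k))

  a-outBlock : inBlock a ≡ false
  a-outBlock = ≥⇒<ᵇ≡false (subst (t ≤_) (sym (trans (toℕ-inject₁ (fromℕ t)) (toℕ-fromℕ t))) ≤-refl)

  b-outBlock : inBlock b ≡ false
  b-outBlock = ≥⇒<ᵇ≡false (subst (t ≤_) (sym (toℕ-fromℕ (suc t))) (n≤1+n t))

  filled-strip : ∀ k l → filled t (strip k) (strip l) ≡ false
  filled-strip k l = cong₂ (λ x y → not (x ∧ y)) (strip-inBlock k) (strip-inBlock l)

  filled-row : ∀ {i} → inBlock i ≡ false → ∀ j → filled t i j ≡ true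
  filled-row i-out j = cong (λ x → not (x ∧ inBlock j)) i-out

  filled-col : ∀ {j} → inBlock j ≡ false → ∀ i → filled t i j ≡ true
  filled-col j-out i = trans (cong (λ y → not (inBlock i ∧ y)) j-out) (cong not (∧-zeroʳ (inBlock i)))

  ∑-supported-on-ab : (p g : Fin n → Bool) → (∀ k → p (strip k) ≡ false) → p a ≡ true → p b ≡ true →
    ∑[ i < n ] ⟦ p i ∧ g i ⟧ ≡ ⟦ g a ⟧ + ⟦ g b ⟧
  ∑-supported-on-ab p g p-strip p-a p-b = begin
    ∑[ i < n ] ⟦ p i ∧ g i ⟧
      ≡⟨ ∑-split (λ i → ⟦ p i ∧ g i ⟧) ⟩
    ∑[ k < t ] ⟦ p (strip k) ∧ g (strip k) ⟧ + ⟦ p a ∧ g a ⟧ + ⟦ p b ∧ g b ⟧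
      ≡⟨ cong₂ _+_ (cong₂ _+_ strips (cong (λ x → ⟦ x ∧ g a ⟧) p-a)) (cong (λ x → ⟦ x ∧ g b ⟧) p-b) ⟩
    ⟦ g a ⟧ + ⟦ g b ⟧ ∎
    where
    open ≡-Reasoning
    strips : ∑[ k < t ] ⟦ p (strip k) ∧ g (strip k) ⟧ ≡ 0
    strips = trans (sum-cong-≗ λ k → cong (λ x → ⟦ x ∧ g (strip k) ⟧) (p-strip k)) (sum-replicate-zero t)

  ∑-strip-row : ∀ k (g : Fin n → Bool) → ∑[ j < n ] ⟦ filled t (strip k) j ∧ g j ⟧ ≡ ⟦ g a ⟧ + ⟦ g b ⟧
  ∑-strip-row k g = ∑-supported-on-ab (filled t (strip k)) g
    (filled-strip k) (filled-col a-outBlock (strip k)) (filled-col b-outBlock (strip k))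

  ∑-strip-col : ∀ l (g : Fin n → Bool) → ∑[ i < n ] ⟦ filled t i (strip l) ∧ g i ⟧ ≡ ⟦ g a ⟧ + ⟦ g b ⟧
  ∑-strip-col l g = ∑-supported-on-ab (λ i → filled t i (strip l)) g
    (λ k → filled-strip k l) (filled-row a-outBlock (strip l)) (filled-row b-outBlock (strip l))

  ∑-rows-ab : (f : Fin n → Fin n → ℕ) →
    ∑[ j < n ] f a j + ∑[ j < n ] f b j
      ≡ ∑[ l < t ] (f a (strip l) + f b (strip l)) + ((f a a + f a b) + (f b a + f b b))
  ∑-rows-ab f = begin
    ∑[ j < n ] f a j + ∑[ j < n ] f b j
      ≡⟨ cong₂ _+_ (∑-split (f a)) (∑-split (f b)) ⟩
    (Sa + f a a + f a b) + (Sb + f b a + f b b)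
      ≡⟨ solve 6 (λ Sa Sb x₁ x₂ x₃ x₄ →
                    (Sa :+ x₁ :+ x₂) :+ (Sb :+ x₃ :+ x₄) := (Sa :+ Sb) :+ ((x₁ :+ x₂) :+ (x₃ :+ x₄))) refl
           Sa Sb (f a a) (f a b) (f b a) (f b b) ⟩
    (Sa + Sb) + ((f a a + f a b) + (f b a + f b b))
      ≡⟨ cong (_+ ((f a a + f a b) + (f b a + f b b))) (sym (∑-distrib-+ (λ l → f a (strip l)) (λ l → f b (strip l)))) ⟩
    ∑[ l < t ] (f a (strip l) + f b (strip l)) + ((f a a + f a b) + (f b a + f b b)) ∎
    where
    open ≡-Reasoning
    Sa Sb : ℕ
    Sa = ∑[ l < t ] f a (strip l)
    Sb = ∑[ l < t ] f b (strip l)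

  ∑∑-filled : (f : Fin n → Fin n → Bool) →
    ∑[ i < n ] ∑[ j < n ] ⟦ filled t i j ∧ f i j ⟧
      ≡ ∑[ k < t ] (⟦ f (strip k) a ⟧ + ⟦ f (strip k) b ⟧)
        + (∑[ l < t ] (⟦ f a (strip l) ⟧ + ⟦ f b (strip l) ⟧)
           + ((⟦ f a a ⟧ + ⟦ f a b ⟧) + (⟦ f b a ⟧ + ⟦ f b b ⟧)))
  ∑∑-filled f = begin
    ∑[ i < n ] ∑[ j < n ] ⟦ filled t i j ∧ f i j ⟧
      ≡⟨ ∑-split (λ i → ∑[ j < n ] ⟦ filled t i j ∧ f i j ⟧) ⟩
    ∑[ k < t ] ∑[ j < n ] ⟦ filled t (strip k) j ∧ f (strip k) j ⟧
      + ∑[ j < n ] ⟦ filled t a j ∧ f a j ⟧ + ∑[ j < n ] ⟦ filled t b j ∧ f b j ⟧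
      ≡⟨ cong₂ _+_ (cong₂ _+_ (sum-cong-≗ λ k → ∑-strip-row k (f (strip k))) (full-row a-outBlock)) (full-row b-outBlock) ⟩
    ∑[ k < t ] (⟦ f (strip k) a ⟧ + ⟦ f (strip k) b ⟧) + ∑[ j < n ] ⟦ f a j ⟧ + ∑[ j < n ] ⟦ f b j ⟧
      ≡⟨ +-assoc (∑[ k < t ] (⟦ f (strip k) a ⟧ + ⟦ f (strip k) b ⟧)) _ _ ⟩
    ∑[ k < t ] (⟦ f (strip k) a ⟧ + ⟦ f (strip k) b ⟧) + (∑[ j < n ] ⟦ f a j ⟧ + ∑[ j < n ] ⟦ f b j ⟧)
      ≡⟨ cong (∑[ k < t ] (⟦ f (strip k) a ⟧ + ⟦ f (strip k) b ⟧) +_) (∑-rows-ab (λ i j → ⟦ f i j ⟧)) ⟩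
    ∑[ k < t ] (⟦ f (strip k) a ⟧ + ⟦ f (strip k) b ⟧)
      + (∑[ l < t ] (⟦ f a (strip l) ⟧ + ⟦ f b (strip l) ⟧)
         + ((⟦ f a a ⟧ + ⟦ f a b ⟧) + (⟦ f b a ⟧ + ⟦ f b b ⟧))) ∎
    where
    open ≡-Reasoning
    full-row : ∀ {i} → inBlock i ≡ false → ∑[ j < n ] ⟦ filled t i j ∧ f i j ⟧ ≡ ∑[ j < n ] ⟦ f i j ⟧
    full-row {i} i-out = sum-cong-≗ λ j → cong (λ x → ⟦ x ∧ f i j ⟧) (filled-row i-out j)

  filled-cells : ∑[ i < n ] ∑[ j < n ] ⟦ filled t i j ⟧ ≡ 4 * suc t
  filled-cells = begin
    ∑[ i < n ] ∑[ j < n ] ⟦ filled t i j ⟧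
      ≡⟨ sum-cong-≗ (λ i → sum-cong-≗ {n} λ j → cong ⟦_⟧ (∧-identityʳ (filled t i j))) ⟨
    ∑[ i < n ] ∑[ j < n ] ⟦ filled t i j ∧ true ⟧ ≡⟨ ∑∑-filled (λ _ _ → true) ⟩
    ∑[ k < t ] 2 + (∑[ l < t ] 2 + 4)
      ≡⟨ cong₂ _+_ (∑-const t 2) (cong (_+ 4) (∑-const t 2)) ⟩
    t * 2 + (t * 2 + 4)
      ≡⟨ solve 1 (λ t → t :* con 2 :+ (t :* con 2 :+ con 4) := con 4 :* (con 1 :+ t)) refl t ⟩
    4 * suc t ∎
    where open ≡-Reasoning

  cornerOf : Array n → Corner
  cornerOf X = corner (X a a) (X a b) (X b a) (X b b)

  stripCol stripRow : Array n → ℕ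
  stripCol X = ∑[ k < t ] ⟦ X (strip k) a ⟧
  stripRow X = ∑[ l < t ] ⟦ X a (strip l) ⟧

  module Square (X : Array n) (X-ifs : IsIFS n t X) where

    open Balanced t X X-ifs

    strip-row-complement : ∀ k → X (strip k) b ≡ not (X (strip k) a)
    strip-row-complement k = ⟦⟧+⟦⟧≡1 (X (strip k) a) (X (strip k) b) (*-cancelˡ-≡ _ 1 2 (begin
      2 * (⟦ X (strip k) a ⟧ + ⟦ X (strip k) b ⟧)
        ≡⟨ cong (2 *_) (∑-strip-row k (X (strip k))) ⟨
      2 * ∑[ j < n ] ⟦ filled t (strip k) j ∧ X (strip k) j ⟧ ≡⟨ row-ones (strip k) ⟩
      ∑[ j < n ] ⟦ filled t (strip k) j ⟧
        ≡⟨ sum-cong-≗ (λ j → cong ⟦_⟧ (∧-identityʳ (filled t (strip k) j))) ⟨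
      ∑[ j < n ] ⟦ filled t (strip k) j ∧ true ⟧
        ≡⟨ ∑-strip-row k (λ _ → true) ⟩
      2 ∎))
      where open ≡-Reasoning

    strip-col-complement : ∀ l → X b (strip l) ≡ not (X a (strip l))
    strip-col-complement l = ⟦⟧+⟦⟧≡1 (X a (strip l)) (X b (strip l)) (*-cancelˡ-≡ _ 1 2 (begin
      2 * (⟦ X a (strip l) ⟧ + ⟦ X b (strip l) ⟧)
        ≡⟨ cong (2 *_) (∑-strip-col l (λ i → X i (strip l))) ⟨
      2 * ∑[ i < n ] ⟦ filled t i (strip l) ∧ X i (strip l) ⟧ ≡⟨ col-ones (strip l) ⟩
      ∑[ i < n ] ⟦ filled t i (strip l) ⟧
        ≡⟨ sum-cong-≗ (λ i → cong ⟦_⟧ (∧-identityʳ (filled t i (strip l)))) ⟨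
      ∑[ i < n ] ⟦ filled t i (strip l) ∧ true ⟧
        ≡⟨ ∑-strip-col l (λ _ → true) ⟩
      2 ∎))
      where open ≡-Reasoning

    row-a≡row-b : ∑[ j < n ] ⟦ X a j ⟧ ≡ ∑[ j < n ] ⟦ X b j ⟧
    row-a≡row-b = halves-equal (full-row-ones a (filled-row a-outBlock))
                               (full-row-ones b (filled-row b-outBlock))

    col-a≡row-a : ∑[ i < n ] ⟦ X i a ⟧ ≡ ∑[ j < n ] ⟦ X a j ⟧
    col-a≡row-a = halves-equal (full-col-ones a (filled-col a-outBlock))
                               (full-row-ones a (filled-row a-outBlock))

    corner-weight : weight (cornerOf X) ≡ 2
    corner-weight = +-cancelˡ-≡ t _ _ (begin
      t + weight (cornerOf X)
        ≡⟨ cong (_+ weight (cornerOf X)) strips ⟨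
      ∑[ l < t ] (⟦ X a (strip l) ⟧ + ⟦ X b (strip l) ⟧) + weight (cornerOf X)
        ≡⟨ ∑-rows-ab (λ i j → ⟦ X i j ⟧) ⟨
      ∑[ j < n ] ⟦ X a j ⟧ + ∑[ j < n ] ⟦ X b j ⟧
        ≡⟨ cong (∑[ j < n ] ⟦ X a j ⟧ +_) (trans (sym row-a≡row-b) (sym (+-identityʳ _))) ⟩
      2 * ∑[ j < n ] ⟦ X a j ⟧
        ≡⟨ full-row-ones a (filled-row a-outBlock) ⟩
      2 + t
        ≡⟨ +-comm 2 t ⟩
      t + 2 ∎)
      where
      open ≡-Reasoning
      strips : ∑[ l < t ] (⟦ X a (strip l) ⟧ + ⟦ X b (strip l) ⟧) ≡ t
      strips = begin
        ∑[ l < t ] (⟦ X a (strip l) ⟧ + ⟦ X b (strip l) ⟧) ≡⟨ sum-cong-≗ complementary ⟩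
        ∑[ l < t ] 1
          ≡⟨ ∑-const t 1 ⟩
        t * 1
          ≡⟨ *-identityʳ t ⟩
        t ∎
        where
        complementary : ∀ l → ⟦ X a (strip l) ⟧ + ⟦ X b (strip l) ⟧ ≡ 1
        complementary l = trans (cong (λ x → ⟦ X a (strip l) ⟧ + ⟦ x ⟧) (strip-col-complement l))
                                (⟦⟧+⟦not⟧ (X a (strip l)))

    strip-balance : stripCol X + ⟦ X b a ⟧ ≡ stripRow X + ⟦ X a b ⟧
    strip-balance = +-cancelˡ-≡ ⟦ X a a ⟧ _ _ (begin
      ⟦ X a a ⟧ + (stripCol X + ⟦ X b a ⟧)
        ≡⟨ middle-to-front (stripCol X) ⟦ X a a ⟧ ⟦ X b a ⟧ ⟨
      stripCol X + ⟦ X a a ⟧ + ⟦ X b a ⟧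
        ≡⟨ ∑-split (λ i → ⟦ X i a ⟧) ⟨
      ∑[ i < n ] ⟦ X i a ⟧
        ≡⟨ col-a≡row-a ⟩
      ∑[ j < n ] ⟦ X a j ⟧
        ≡⟨ ∑-split (λ j → ⟦ X a j ⟧) ⟩
      stripRow X + ⟦ X a a ⟧ + ⟦ X a b ⟧
        ≡⟨ middle-to-front (stripRow X) ⟦ X a a ⟧ ⟦ X a b ⟧ ⟩
      ⟦ X a a ⟧ + (stripRow X + ⟦ X a b ⟧) ∎)
      where
      open ≡-Reasoning
      middle-to-front : ∀ p x y → p + x + y ≡ x + (p + y)
      middle-to-front = solve 3 (λ p x y → p :+ x :+ y := x :+ (p :+ y)) refl

  module Pair (A B : Array n) (A-ifs : IsIFS n t A) (B-ifs : IsIFS n t B) (A⊥B : Orthogonal n t A B) where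

    private
      module A = Square A A-ifs
      module B = Square B B-ifs

    N : Bool → Bool → ℕ
    N = pairCount n t A B

    indicator : Bool → Bool → Fin n → Fin n → ℕ
    indicator u v i j = ⟦ filled t i j ∧ (A i j == u) ∧ (B i j == v) ⟧

    N-cells : ∀ u v → N u v ≡ ∑[ i < n ] ∑[ j < n ] indicator u v i j
    N-cells u v = count-cells (λ { (i , j) → filled t i j ∧ (A i j == u) ∧ (B i j == v) })

    N-total : N false false + N false true + N true false + N true true ≡ 4 * suc t
    N-total = begin
      N false false + N false true + N true false + N true true
        ≡⟨ cong₂ _+_ (cong₂ _+_ (cong₂ _+_ (N-cells false false) (N-cells false true)) (N-cells true false))
                     (N-cells true true) ⟩
      ∑∑ g₀₀ + ∑∑ g₀₁ + ∑∑ g₁₀ + ∑∑ g₁₁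
        ≡⟨ cong (λ x → x + ∑∑ g₁₀ + ∑∑ g₁₁) (∑∑-distrib-+ g₀₀ g₀₁) ⟩
      ∑∑ (g₀₀ ⊕ g₀₁) + ∑∑ g₁₀ + ∑∑ g₁₁
        ≡⟨ cong (_+ ∑∑ g₁₁) (∑∑-distrib-+ (g₀₀ ⊕ g₀₁) g₁₀) ⟩
      ∑∑ (g₀₀ ⊕ g₀₁ ⊕ g₁₀) + ∑∑ g₁₁
        ≡⟨ ∑∑-distrib-+ (g₀₀ ⊕ g₀₁ ⊕ g₁₀) g₁₁ ⟩
      ∑∑ (g₀₀ ⊕ g₀₁ ⊕ g₁₀ ⊕ g₁₁)
        ≡⟨ sum-cong-≗ (λ i → sum-cong-≗ λ j → ⟦∧==∧==⟧-partition (filled t i j) (A i j) (B i j)) ⟩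
      ∑∑ (λ i j → ⟦ filled t i j ⟧)
        ≡⟨ filled-cells ⟩
      4 * suc t ∎
      where
      open ≡-Reasoning
      ∑∑ : (Fin n → Fin n → ℕ) → ℕ
      ∑∑ f = ∑[ i < n ] ∑[ j < n ] f i j
      _⊕_ : (f g : Fin n → Fin n → ℕ) → Fin n → Fin n → ℕ
      (f ⊕ g) i j = f i j + g i j
      infixl 6 _⊕_
      g₀₀ g₀₁ g₁₀ g₁₁ : Fin n → Fin n → ℕ
      g₀₀ = indicator false false
      g₀₁ = indicator false true
      g₁₀ = indicator true false
      g₁₁ = indicator true true

    N₁₁≡1+t : N true true ≡ suc t
    N₁₁≡1+t = *-cancelˡ-≡ _ _ 4 (begin
      4 * N true true
        ≡⟨ solve 1 (λ x → con 4 :* x := x :+ x :+ x :+ x) refl (N true true) ⟩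
      N true true + N true true + N true true + N true true
        ≡⟨ cong (_+ N true true) (cong₂ _+_ (cong₂ _+_ N₀₀≡N₁₁ N₀₁≡N₁₁) N₁₀≡N₁₁) ⟨
      N false false + N false true + N true false + N true true
        ≡⟨ N-total ⟩
      4 * suc t ∎)
      where
      open ≡-Reasoning
      N₁₀≡N₁₁ : N true false ≡ N true true
      N₁₀≡N₁₁ = proj₂ (proj₂ A⊥B)
      N₀₁≡N₁₁ : N false true ≡ N true true
      N₀₁≡N₁₁ = trans (proj₁ (proj₂ A⊥B)) N₁₀≡N₁₁
      N₀₀≡N₁₁ : N false false ≡ N true true
      N₀₀≡N₁₁ = trans (proj₁ A⊥B) N₀₁≡N₁₁

    agree-col agree-row shared-col shared-row shared-corner Δ ρ : ℕ
    agree-col = ∑[ k < t ] ⟦ A (strip k) a == B (strip k) a ⟧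
    agree-row = ∑[ l < t ] ⟦ A a (strip l) == B a (strip l) ⟧
    shared-col = ∑[ k < t ] ⟦ A (strip k) a ∧ B (strip k) a ⟧
    shared-row = ∑[ l < t ] ⟦ A a (strip l) ∧ B a (strip l) ⟧
    shared-corner = sharedOnes (cornerOf A) (cornerOf B)
    Δ = shared-corner + offDiagonal (cornerOf A) + offDiagonal (cornerOf B)
    ρ = (stripRow A + ⟦ A a b ⟧) + (stripRow B + ⟦ B a b ⟧)

    N₁₁-split : N true true ≡ agree-col + (agree-row + shared-corner)
    N₁₁-split = begin
      N true true
        ≡⟨ N-cells true true ⟩
      ∑[ i < n ] ∑[ j < n ] indicator true true i j
        ≡⟨ sum-cong-≗ (λ i → sum-cong-≗ {n} λ j →
             cong₂ (λ x y → ⟦ filled t i j ∧ x ∧ y ⟧) (==-true (A i j)) (==-true (B i j))) ⟩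
      ∑[ i < n ] ∑[ j < n ] ⟦ filled t i j ∧ A i j ∧ B i j ⟧
        ≡⟨ ∑∑-filled (λ i j → A i j ∧ B i j) ⟩
      ∑[ k < t ] (⟦ A (strip k) a ∧ B (strip k) a ⟧ + ⟦ A (strip k) b ∧ B (strip k) b ⟧)
        + (∑[ l < t ] (⟦ A a (strip l) ∧ B a (strip l) ⟧ + ⟦ A b (strip l) ∧ B b (strip l) ⟧)
           + sharedOnes (cornerOf A) (cornerOf B))
        ≡⟨ cong₂ _+_ (sum-cong-≗ row-agreement) (cong (_+ shared-corner) (sum-cong-≗ col-agreement)) ⟩
      ∑[ k < t ] ⟦ A (strip k) a == B (strip k) a ⟧
        + (∑[ l < t ] ⟦ A a (strip l) == B a (strip l) ⟧ + sharedOnes (cornerOf A) (cornerOf B)) ∎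
      where
      open ≡-Reasoning
      row-agreement : ∀ k → ⟦ A (strip k) a ∧ B (strip k) a ⟧ + ⟦ A (strip k) b ∧ B (strip k) b ⟧
                          ≡ ⟦ A (strip k) a == B (strip k) a ⟧
      row-agreement k = trans
        (cong₂ (λ x y → ⟦ A (strip k) a ∧ B (strip k) a ⟧ + ⟦ x ∧ y ⟧)
               (A.strip-row-complement k) (B.strip-row-complement k))
        (⟦∧⟧+⟦not∧not⟧ (A (strip k) a) (B (strip k) a))
      col-agreement : ∀ l → ⟦ A a (strip l) ∧ B a (strip l) ⟧ + ⟦ A b (strip l) ∧ B b (strip l) ⟧
                          ≡ ⟦ A a (strip l) == B a (strip l) ⟧
      col-agreement l = trans
        (cong₂ (λ x y → ⟦ A a (strip l) ∧ B a (strip l) ⟧ + ⟦ x ∧ y ⟧)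
               (A.strip-col-complement l) (B.strip-col-complement l))
        (⟦∧⟧+⟦not∧not⟧ (A a (strip l)) (B a (strip l)))

    N₁₁-mod-2 : N true true + 2 * ρ ≡ Δ + 2 * (t + shared-col + shared-row)
    N₁₁-mod-2 = begin
      N true true + 2 * ρ
        ≡⟨ cong₂ _+_ N₁₁-split (double ρ) ⟩
      (agree-col + (agree-row + shared-corner)) + (ρ + ρ)
        ≡⟨ cong (λ x → (agree-col + (agree-row + shared-corner)) + (x + ρ))
                (cong₂ _+_ A.strip-balance B.strip-balance) ⟨
      (agree-col + (agree-row + shared-corner)) + ((stripCol A + ⟦ A b a ⟧ + (stripCol B + ⟦ B b a ⟧)) + ρ)
        ≡⟨ regroup agree-col agree-row shared-corner (stripCol A) (stripCol B) (stripRow A) (stripRow B)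
                   ⟦ A a b ⟧ ⟦ A b a ⟧ ⟦ B a b ⟧ ⟦ B b a ⟧ ⟩
      (agree-col + (stripCol A + stripCol B)) + (agree-row + (stripRow A + stripRow B)) + Δ
        ≡⟨ cong (_+ Δ) (cong₂ _+_ (∑-agreements (λ k → A (strip k) a) (λ k → B (strip k) a))
                                   (∑-agreements (λ l → A a (strip l)) (λ l → B a (strip l)))) ⟩
      (t + 2 * shared-col) + (t + 2 * shared-row) + Δ
        ≡⟨ solve 4 (λ t c r d → (t :+ con 2 :* c) :+ (t :+ con 2 :* r) :+ d := d :+ con 2 :* (t :+ c :+ r))
                 refl t shared-col shared-row Δ ⟩
      Δ + 2 * (t + shared-col + shared-row) ∎
      where
      open ≡-Reasoning
      double : ∀ x → 2 * x ≡ x + x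
      double x = cong (x +_) (+-identityʳ x)
      regroup : ∀ ac ar s cA cB rA rB xA yA xB yB →
        (ac + (ar + s)) + ((cA + yA + (cB + yB)) + ((rA + xA) + (rB + xB)))
          ≡ (ac + (cA + cB)) + (ar + (rA + rB)) + (s + (xA + yA) + (xB + yB))
      regroup = solve 11 (λ ac ar s cA cB rA rB xA yA xB yB →
        (ac :+ (ar :+ s)) :+ ((cA :+ yA :+ (cB :+ yB)) :+ ((rA :+ xA) :+ (rB :+ xB)))
          := (ac :+ (cA :+ cB)) :+ (ar :+ (rA :+ rB)) :+ (s :+ (xA :+ yA) :+ (xB :+ yB))) refl

    compatible : parity t ≡ 0ℙ → Compatible (cornerOf A) (cornerOf B)
    compatible t-even = begin
      parity Δ
        ≡⟨ parity-+-double Δ (t + shared-col + shared-row) ⟨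
      parity (Δ + 2 * (t + shared-col + shared-row)) ≡⟨ cong parity N₁₁-mod-2 ⟨
      parity (N true true + 2 * ρ)
        ≡⟨ parity-+-double (N true true) ρ ⟩
      parity (N true true)
        ≡⟨ cong parity N₁₁≡1+t ⟩
      parity (1 + t)
        ≡⟨ +-homo-+ 1 t ⟩
      1ℙ ℙ.+ parity t
        ≡⟨ cong (1ℙ ℙ.+_) t-even ⟩
      1ℙ ∎
      where open ≡-Reasoning

lemma6p3 : (n : ℕ) → Σ ℕ (λ m → n ≡ 2 * m) → 4 ≤ n →
    ¬ (Σ (Fin 3 → Array n) (λ F → IMOFS 3 n (n ∸ 2) F))
lemma6p3 zero _ ()
lemma6p3 (suc zero) _ (s≤s ())
lemma6p3 (suc (suc t)) (m , n≡2m) _ (F , F-ifs , F-orth) =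
  no-compatible-triangle (cornerOf (F 0F)) (cornerOf (F 1F)) (cornerOf (F 2F))
    (weight-2 0F , weight-2 1F , weight-2 2F ,
     compatible 0F 1F (λ ()) , compatible 0F 2F (λ ()) , compatible 1F 2F (λ ()))
  where
  open Border t
  t-even : parity t ≡ 0ℙ
  t-even = trans (cong parity n≡2m) (*-homo-* 2 m)
  weight-2 : ∀ i → weight (cornerOf (F i)) ≡ 2
  weight-2 i = Square.corner-weight (F i) (F-ifs i)
  compatible : ∀ i j → ¬ i ≡ j → Compatible (cornerOf (F i)) (cornerOf (F j))
  compatible i j i≢j = Pair.compatible (F i) (F j) (F-ifs i) (F-ifs j) (F-orth i j i≢j) t-even
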